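{- The variety $\mathbf{DMSt}$ of De Morgan Stone semi-Heyting algebras is at level $2$; that is, every De Morgan Stone semi-Heyting algebra satisfies $t_2(x)\approx t_3(x)$.
   Context: A semi-Heyting algebra is an algebra $\langle L,\vee,\wedge,\to,0,1\rangle$ such that $\langle L,\vee,\wedge,0,1\rangle$ is a bounded lattice and the identities $x\wedge(x\to y)\approx x\wedge y$, $x\wedge(y\to z)\approx x\wedge[(x\wedge y)\to(x\wedge z)]$, and $x\to x\approx 1$ hold; $x^* := x\to 0$ is the pseudocomplement. A dually quasi-De Morgan semi-Heyting algebra is an algebra $\langle L,\vee,\wedge,\to,{}',0,1\rangle$ whose reduct $\langle L,\vee,\wedge,\to,0,1\rangle$ is a semi-Heyting algebra and which satisfies $0'\approx 1$, $1'\approx 0$, $(x\wedge y)'\approx x'\vee y'$, $(x\vee y)''\approx x''\vee y''$, and $x''\le x$. A De Morgan Stone semi-Heyting algebra is such an algebra satisfying $x''\approx x$ and the Stone identity $x^*\vee x^{**}\approx 1$. Define $x^{0('^*)} := x$, $x^{(k+1)('^*)} := ((x^{k('^*)})')^*$, $t_0(x):=x$, $t_{k+1}(x):=t_k(x)\wedge x^{(k+1)('^*)}$. A variety is at level $n$ if it satisfies $t_n(x)\approx t_{n+1}(x)$. -}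

module Defs where

open import Level using (Level; suc)
open import Data.Nat using (ℕ; zero) renaming (suc to sucℕ)
open import Relation.Binary.PropositionalEquality using (_≡_)

record DMStSH (a : Level) : Set (suc a) where
  infixr 6 _∨_
  infixr 7 _∧_
  infixr 5 _⇒_
  field
    Carrier : Set a
    _∨_ _∧_ _⇒_ : Carrier → Carrier → Carrier
    _′ : Carrier → Carrier
    𝟎 𝟏 : Carrier
    ∨-comm   : ∀ x y → x ∨ y ≡ y ∨ x
    ∧-comm   : ∀ x y → x ∧ y ≡ y ∧ x
    ∨-assoc  : ∀ x y z → (x ∨ y) ∨ z ≡ x ∨ (y ∨ z)
    ∧-assoc  : ∀ x y z → (x ∧ y) ∧ z ≡ x ∧ (y ∧ z)
    ∨-absorbs-∧ : ∀ x y → x ∨ (x ∧ y) ≡ x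
    ∧-absorbs-∨ : ∀ x y → x ∧ (x ∨ y) ≡ x
    ∨-identity : ∀ x → x ∨ 𝟎 ≡ x
    ∧-identity : ∀ x → x ∧ 𝟏 ≡ x
    sh1 : ∀ x y → x ∧ (x ⇒ y) ≡ x ∧ y
    sh2 : ∀ x y z → x ∧ (y ⇒ z) ≡ x ∧ ((x ∧ y) ⇒ (x ∧ z))
    sh3 : ∀ x → x ⇒ x ≡ 𝟏
    0′ : 𝟎 ′ ≡ 𝟏
    1′ : 𝟏 ′ ≡ 𝟎
    ∧′ : ∀ x y → (x ∧ y) ′ ≡ (x ′) ∨ (y ′)
    ∨′′ : ∀ x y → ((x ∨ y) ′) ′ ≡ ((x ′) ′) ∨ ((y ′) ′)
    ′′≤ : ∀ x → ((x ′) ′) ∧ x ≡ ((x ′) ′)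
    ′′-inv : ∀ x → (x ′) ′ ≡ x
    stone : ∀ x → ((x ⇒ 𝟎) ∨ ((x ⇒ 𝟎) ⇒ 𝟎)) ≡ 𝟏

module Terms {a : Level} (L : DMStSH a) where
  open DMStSH L

  _* : Carrier → Carrier
  x * = x ⇒ 𝟎

  iter′* : ℕ → Carrier → Carrier
  iter′* zero x = x
  iter′* (sucℕ k) x = ((iter′* k x) ′) *

  t : ℕ → Carrier → Carrier
  t zero x = x
  t (sucℕ k) x = t k x ∧ iter′* (sucℕ k) x

module Submission where

-- Put a = x^{1('*)} = x'*.  By the Stone identity a is
-- complemented, with complement a*.  The De Morgan involution ' maps a
-- complemented pair to a complemented pair, and in a semi-Heyting algebra
-- the complement of an element, when it exists, is its pseudocomplement.
-- Hence a'* = a*', and therefore x^{3('*)} = a'*'* = a*''* = a** = a, i.e.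
-- x^{3('*)} = x^{1('*)}.  Since t_2(x) ≤ t_1(x) ≤ x^{1('*)}, this gives
-- t_3(x) = t_2(x) ∧ x^{1('*)} = t_2(x).

open import Defs
open import Level using (Level)
open import Data.Nat using (suc; _+_)
open import Data.Product using (_,_)
open import Relation.Binary.PropositionalEquality
  using (_≡_; sym; trans; cong; cong₂; isEquivalence; module ≡-Reasoning)
open import Algebra.Lattice.Bundles using (Lattice)
import Algebra.Lattice.Properties.Lattice as LatticeProperties
import Relation.Binary.Lattice as Order
import Relation.Binary.Reasoning.PartialOrder as ≤-Reasoning

module DMStProperties {a : Level} (L : DMStSH a) where
  open DMStSH L
  open Terms L

  lattice : Lattice a a
  lattice = record
    { Carrier   = Carrier
    ; _≈_       = _≡_
    ; _∨_       = _∨_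
    ; _∧_       = _∧_
    ; isLattice = record
      { isEquivalence = isEquivalence
      ; ∨-comm        = ∨-comm
      ; ∨-assoc       = ∨-assoc
      ; ∨-cong        = cong₂ _∨_
      ; ∧-comm        = ∧-comm
      ; ∧-assoc       = ∧-assoc
      ; ∧-cong        = cong₂ _∧_
      ; absorptive    = ∨-absorbs-∧ , ∧-absorbs-∨
      }
    }

  -- Its lattice order: x ≤ y means x ≡ x ∧ y.
  orderLattice : Order.Lattice a a a
  orderLattice = LatticeProperties.∨-∧-orderTheoreticLattice lattice

  open Order.Lattice orderLattice public
    using (_≤_; poset; antisym; x∧y≤x; x∧y≤y; ∧-greatest; ∨-least)
    renaming (trans to ≤-trans; refl to ≤-refl)
  open ≤-Reasoning poset

  𝟎-≤ : ∀ x → 𝟎 ≤ x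
  𝟎-≤ x = sym (begin-equality
    𝟎 ∧ x        ≡⟨ cong (𝟎 ∧_) (sym (trans (∨-comm 𝟎 x) (∨-identity x))) ⟩
    𝟎 ∧ (𝟎 ∨ x)  ≡⟨ ∧-absorbs-∨ 𝟎 x ⟩
    𝟎            ∎)

  ∧-zeroʳ : ∀ x → x ∧ 𝟎 ≡ 𝟎
  ∧-zeroʳ x = antisym (x∧y≤y x 𝟎) (𝟎-≤ (x ∧ 𝟎))

  -- Residuation: in a semi-Heyting algebra  x ∧ y ≤ z  iff
  -- x ≤ y → (y ∧ z).  (For Heyting algebras y → (y ∧ z) = y → z.)
  residuate : ∀ {x y z} → x ∧ y ≤ z → x ≤ y ⇒ (y ∧ z)
  residuate {x} {y} {z} x∧y≤z = sym (begin-equality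
    x ∧ (y ⇒ (y ∧ z))              ≡⟨ sh2 x y (y ∧ z) ⟩
    x ∧ ((x ∧ y) ⇒ (x ∧ (y ∧ z)))  ≡⟨ cong (λ u → x ∧ ((x ∧ y) ⇒ u)) x∧y∧z≡x∧y ⟩
    x ∧ ((x ∧ y) ⇒ (x ∧ y))        ≡⟨ cong (x ∧_) (sh3 (x ∧ y)) ⟩
    x ∧ 𝟏                          ≡⟨ ∧-identity x ⟩
    x                              ∎)
    where
    x∧y∧z≡x∧y : x ∧ (y ∧ z) ≡ x ∧ y
    x∧y∧z≡x∧y = trans (sym (∧-assoc x y z)) (sym x∧y≤z)

  unresiduate : ∀ {x y z} → x ≤ y ⇒ (y ∧ z) → x ∧ y ≤ z
  unresiduate {x} {y} {z} x≤y⇒y∧z = begin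
    x ∧ y                  ≤⟨ ∧-greatest (x∧y≤y x y) (≤-trans (x∧y≤x x y) x≤y⇒y∧z) ⟩
    y ∧ (y ⇒ (y ∧ z))      ≡⟨ sh1 y (y ∧ z) ⟩
    y ∧ (y ∧ z)            ≤⟨ x∧y≤y y (y ∧ z) ⟩
    y ∧ z                  ≤⟨ x∧y≤y y z ⟩
    z                      ∎

  -- Consequently meet distributes over join (stated in order form),
  -- which is what uniqueness of complements needs.
  ∧-∨-bound : ∀ {x y z w} → x ∧ y ≤ w → x ∧ z ≤ w → x ∧ (y ∨ z) ≤ w
  ∧-∨-bound {x} {y} {z} {w} x∧y≤w x∧z≤w = begin
    x ∧ (y ∨ z)  ≡⟨ ∧-comm x (y ∨ z) ⟩
    (y ∨ z) ∧ x  ≤⟨ unresiduate (∨-least (residuate (flip y x∧y≤w)) (residuate (flip z x∧z≤w))) ⟩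
    w            ∎
    where
    flip : ∀ u → x ∧ u ≤ w → u ∧ x ≤ w
    flip u x∧u≤w = begin
      u ∧ x  ≡⟨ ∧-comm u x ⟩
      x ∧ u  ≤⟨ x∧u≤w ⟩
      w      ∎

  ∧-* : ∀ x → x ∧ (x *) ≡ 𝟎
  ∧-* x = trans (sh1 x 𝟎) (∧-zeroʳ x)

  disjoint-≤-* : ∀ {z y} → z ∧ y ≡ 𝟎 → z ≤ y *
  disjoint-≤-* {z} {y} z∧y≡𝟎 = begin
    z              ≤⟨ residuate z∧y≤𝟎 ⟩
    y ⇒ (y ∧ 𝟎)    ≡⟨ cong (y ⇒_) (∧-zeroʳ y) ⟩
    y *            ∎
    where
    z∧y≤𝟎 : z ∧ y ≤ 𝟎
    z∧y≤𝟎 = begin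
      z ∧ y  ≡⟨ z∧y≡𝟎 ⟩
      𝟎      ∎

  record Complements (z w : Carrier) : Set a where
    field
      meet-𝟎 : z ∧ w ≡ 𝟎
      join-𝟏 : z ∨ w ≡ 𝟏

  complements-sym : ∀ {z w} → Complements z w → Complements w z
  complements-sym {z} {w} c = record
    { meet-𝟎 = trans (∧-comm w z) meet-𝟎
    ; join-𝟏 = trans (∨-comm w z) join-𝟏
    }
    where open Complements c

  complement-is-* : ∀ {z w} → Complements z w → z * ≡ w
  complement-is-* {z} {w} c = antisym z*≤w w≤z*
    where
    open Complements c
    z*∧z≤w : (z *) ∧ z ≤ w
    z*∧z≤w = begin
      (z *) ∧ z  ≡⟨ ∧-comm (z *) z ⟩
      z ∧ (z *)  ≡⟨ ∧-* z ⟩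
      𝟎          ≤⟨ 𝟎-≤ w ⟩
      w          ∎
    z*≤w : z * ≤ w
    z*≤w = begin
      z *              ≡⟨ sym (∧-identity (z *)) ⟩
      (z *) ∧ 𝟏        ≡⟨ cong ((z *) ∧_) (sym join-𝟏) ⟩
      (z *) ∧ (z ∨ w)  ≤⟨ ∧-∨-bound z*∧z≤w (x∧y≤y (z *) w) ⟩
      w                ∎
    w≤z* : w ≤ z *
    w≤z* = disjoint-≤-* (trans (∧-comm w z) meet-𝟎)

  stone-complements : ∀ y → Complements (y *) ((y *) *)
  stone-complements y = record { meet-𝟎 = ∧-* (y *) ; join-𝟏 = stone y }

  ∨-′ : ∀ u v → (u ∨ v) ′ ≡ (u ′) ∧ (v ′)
  ∨-′ u v = begin-equality
    (u ∨ v) ′                ≡⟨ cong (λ p → (p ∨ v) ′) (sym (′′-inv u)) ⟩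
    ((u ′ ′) ∨ v) ′          ≡⟨ cong (λ q → ((u ′ ′) ∨ q) ′) (sym (′′-inv v)) ⟩
    ((u ′ ′) ∨ (v ′ ′)) ′    ≡⟨ cong _′ (sym (∧′ (u ′) (v ′))) ⟩
    ((u ′) ∧ (v ′)) ′ ′      ≡⟨ ′′-inv ((u ′) ∧ (v ′)) ⟩
    (u ′) ∧ (v ′)            ∎

  ′-complements : ∀ {z w} → Complements z w → Complements (z ′) (w ′)
  ′-complements {z} {w} c = record
    { meet-𝟎 = trans (sym (∨-′ z w)) (trans (cong _′ join-𝟏) 1′)
    ; join-𝟏 = trans (sym (∧′ z w)) (trans (cong _′ meet-𝟎) 0′)
    }
    where open Complements c

  ′*′*-fixes-complemented : ∀ {z w} → Complements z w → (((z ′) *) ′) * ≡ z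
  ′*′*-fixes-complemented {z} {w} c = begin-equality
    (((z ′) *) ′) *  ≡⟨ cong (λ u → (u ′) *) (complement-is-* (′-complements c)) ⟩
    ((w ′) ′) *      ≡⟨ cong _* (′′-inv w) ⟩
    w *              ≡⟨ complement-is-* (complements-sym c) ⟩
    z                ∎

  -- Hence the sequence x^{k('*)} is 2-periodic from k = 1 on, because
  -- x^{(k+1)('*)} is a pseudocomplement and so complemented.
  iter′*-period : ∀ k x → iter′* (3 + k) x ≡ iter′* (1 + k) x
  iter′*-period k x = ′*′*-fixes-complemented (stone-complements (iter′* k x ′))

  t-≤-iter′* : ∀ k x → t k x ≤ iter′* k x
  t-≤-iter′* 0       x = ≤-refl
  t-≤-iter′* (suc k) x = x∧y≤y (t k x) (iter′* (suc k) x)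

  t-antitone : ∀ k x → t (suc k) x ≤ t k x
  t-antitone k x = x∧y≤x (t k x) (iter′* (suc k) x)

corollary4p10 : ∀ {a : Level} (L : DMStSH a) (x : DMStSH.Carrier L) →
                  Terms.t L 2 x ≡ Terms.t L 3 x
corollary4p10 L x = begin
  t 2 x                 ≡⟨ t₂≤x¹ ⟩
  t 2 x ∧ iter′* 1 x    ≡⟨ cong (t 2 x ∧_) (sym (iter′*-period 0 x)) ⟩
  t 2 x ∧ iter′* 3 x    ∎
  where
  open DMStSH L
  open Terms L
  open DMStProperties L using (_≤_; ≤-trans; t-≤-iter′*; t-antitone; iter′*-period)
  open ≡-Reasoning
  -- in the lattice order, t₂(x) ≤ x^{1('*)} means t₂(x) ≡ t₂(x) ∧ x^{1('*)}
  t₂≤x¹ : t 2 x ≤ iter′* 1 x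
  t₂≤x¹ = ≤-trans (t-antitone 1 x) (t-≤-iter′* 1 x)
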